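{- Let $n\ge3$ be odd, let $C$ be a nonzero integer, and let $B=f^2B_0$ with $f$ a nonzero integer and $B_0\neq-1$ squarefree. Let $K=\mathbb{Q}(\sqrt{ -B})$ with ring of integers $\mathcal{O}_K$. If $(x,y,z)\in\mathbb{Z}^3$ is a primitive solution ($\gcd(x,y,z)=1$) of $x^2+By^2=Cz^n$, then the triple $(u,v,w)=(x+\sqrt{ -B}\,y,\;x-\sqrt{ -B}\,y,\;z)\in\mathcal{O}_K^3$ (where $\sqrt{ -B}=f\sqrt{ -B_0}$) satisfies $uv=Cw^n$ and $\min\{v_{\mathfrak p}(u),v_{\mathfrak p}(v),v_{\mathfrak p}(w)\}=0$ for every prime $\mathfrak p$ of $\mathcal{O}_K$ not dividing $2f$; that is, the image of $\mathcal{Y}_{B,C}(\mathbb{Z})$ under the map $[x:y:z]\mapsto[x+\sqrt{ -B}y:x-\sqrt{ -B}y:z]$ lies in $\mathcal{Y}'(\mathcal{O}_K[1/(2f)])$. In particular, if $B$ is squarefree, the image lies in $\mathcal{Y}'(\mathcal{O}_K[1/2])$.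
   Context: $\mathcal{Y}_{B,C}=[S/\mathbb{G}_m]$ with $S:x^2+By^2=Cz^n$ minus the origin, $\mathbb{G}_m$ acting with weights $(n,n,2)$; $\mathcal{Y}_{B,C}(\mathbb{Z})$ consists of primitive integer solutions $[x:y:z]$. $\mathcal{Y}'=[S'/\mathbb{G}_m]$ where $S'=\operatorname{Spec}\mathbb{Z}[u,v,w]/(uv-Cw^n)\smallsetminus\{(0,0,0)\}$ with $\lambda$ acting by $(u,v,w)\mapsto(\lambda^nu,\lambda^nv,\lambda^2w)$. For a Dedekind domain $R$ with fraction field $F$, a point $[u:v:w]$ with $u,v,w\in F$, $uv=Cw^n$, is an $R$-point if for every prime $\mathfrak p$ of $R$ some representative has $\min\{v_{\mathfrak p}(u)/n,v_{\mathfrak p}(v)/n,v_{\mathfrak p}(w)/2\}\in\mathbb{Z}$; for $u,v,w\in\mathcal{O}_K$ this holds in particular when the minimum of the valuations is $0$. -}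

module Defs where

open import Data.Bool using (Bool; true; false; if_then_else_)
open import Data.Nat as ℕ using (ℕ; zero; suc)
open import Data.Integer
  using (ℤ; +_; -_; _+_; _-_; _*_; ∣_∣; _%_; _/_)
open import Data.Integer.Divisibility using (_∣_)
open import Data.Product using (Σ; _×_; _,_; proj₁; proj₂)
open import Data.Sum using (_⊎_)
open import Relation.Binary.PropositionalEquality using (_≡_)
open import Relation.Nullary using (¬_)

-- Squarefree integers: no square of a non-unit divides it.
-- (In particular 0 is not squarefree.)
SquareFree : ℤ → Set
SquareFree m = ∀ (k : ℤ) → (k * k) ∣ m → ∣ k ∣ ≡ 1

-- The ring of integers O_K of K = ℚ(√d), d = -B₀ squarefree, d ≠ 1.
-- Standard integral basis {1, ω}:
--   d ≡ 1 (mod 4) : ω = (1 + √d)/2,  ω² = ω + (d-1)/4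
--   otherwise     : ω = √d,          ω² = d
-- So ω² = tω + c with (t , c) given below.  An element a + bω of O_K
-- is represented by the pair (a , b) ∈ ℤ × ℤ (unique representation).

d≡1mod4 : ℤ → Bool
d≡1mod4 d = (d % + 4) ℕ.≡ᵇ 1

ωt : ℤ → ℤ
ωt d = if d≡1mod4 d then + 1 else + 0

ωc : ℤ → ℤ
ωc d = if d≡1mod4 d then (d - + 1) / + 4 else d

𝒪 : Set
𝒪 = ℤ × ℤ

ι : ℤ → 𝒪
ι a = (a , + 0)

𝟎 𝟏 : 𝒪
𝟎 = ι (+ 0)
𝟏 = ι (+ 1)

add : 𝒪 → 𝒪 → 𝒪
add (a , b) (a' , b') = (a + a' , b + b')

neg : 𝒪 → 𝒪
neg (a , b) = (- a , - b)

mul : ℤ → 𝒪 → 𝒪 → 𝒪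
mul d (a , b) (a' , b') =
  (a * a' + b * b' * ωc d , a * b' + a' * b + b * b' * ωt d)

pow : ℤ → 𝒪 → ℕ → 𝒪
pow d x zero    = 𝟏
pow d x (suc k) = mul d x (pow d x k)

-- √d in the basis {1, ω}: √d = ω, resp. √d = 2ω - 1.
sqrtd : ℤ → 𝒪
sqrtd d = if d≡1mod4 d then (- + 1 , + 2) else (+ 0 , + 1)

record IsPrimeIdeal (d : ℤ) (P : 𝒪 → Set) : Set₁ where
  field
    zero∈      : P 𝟎
    +-closed   : ∀ x y → P x → P y → P (add x y)
    *-closed   : ∀ r x → P x → P (mul d r x)
    proper     : ¬ P 𝟏
    prime      : ∀ x y → P (mul d x y) → P x ⊎ P y
    nonzero    : Σ 𝒪 (λ x → P x × ¬ x ≡ 𝟎)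

-- For u, v, w ∈ O_K (so all valuations are ≥ 0):
-- min{v_𝔭(u), v_𝔭(v), v_𝔭(w)} = 0  ⇔  not all of u, v, w lie in 𝔭
-- (v_𝔭(x) ≥ 1 ⇔ x ∈ 𝔭).
MinVal0 : (P : 𝒪 → Set) → 𝒪 → 𝒪 → 𝒪 → Set
MinVal0 P u v w = ¬ (P u × P v × P w)

-- Since u + v = 2x and u − v = 2y√(−B), a prime 𝔭 ∤ 2f containing u, v and w = z
-- contains x, z and y√(−B), hence (as f ∉ 𝔭) y or √(−B₀).  If it contains y, it contains
-- gcd(x, y, z) = 1.  If it contains √(−B₀), it contains B₀, so it lies over a prime
-- p ∣ B₀ with p ∣ x and p ∣ z; then p² divides x² and zⁿ, hence f²B₀y², and as B₀ is
-- squarefree and p ∤ f this forces p ∣ y, again putting y in 𝔭.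
module Submission where

open import Defs
open import Data.Nat as ℕ using (ℕ; _≥_)
open import Data.Integer using (ℤ; +_; -_; _+_; _-_; _*_; _^_; ∣_∣)
open import Data.Integer.GCD using (gcd)
open import Data.Product using (_×_; _,_)
open import Relation.Binary.PropositionalEquality using (_≡_)
open import Relation.Nullary using (¬_)

open import Data.Bool using (true; false; T)
open import Data.Empty using (⊥-elim)
open import Data.Integer using (-[1+_]; -1ℤ; 1ℤ; _/_; _%_; NonZero)
open import Data.Integer.DivMod using (a≡a%n+[a/n]*n; n%d<d)
open import Data.Integer.Divisibility.Signed
  using (_∣_; divides; ∣ᵤ⇒∣; ∣⇒∣ᵤ; ∣-refl; ∣-trans; m∣∣m∣;
         ∣m⇒∣m*n; ∣n⇒∣m*n; ∣m+n∣m⇒∣n; *-monoʳ-∣; *-monoˡ-∣; *-cancelˡ-∣)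
open import Data.Integer.Properties
  using (abs-*; +-identityˡ; pos-+; pos-*; -1*i≡-i; *-zeroʳ; neg-involutive)
open import Data.Integer.Tactic.RingSolver using (solve-∀)
open import Data.List using ([]; _∷_)
open import Data.List.Relation.Unary.All using (All; []; _∷_)
import Data.Nat.GCD as ℕ
open import Data.Nat.GCD using (module Bézout)
open import Data.Nat.ListAction using (product)
import Data.Nat.Properties as ℕ
import Data.Nat.Divisibility as ℕ
open import Data.Nat.Primality
  using (Prime; euclidsLemma; prime⇒irreducible; prime⇒nonZero; ¬prime[1])
open import Data.Nat.Primality.Factorisation using (factorise; PrimeFactorisation)
open import Data.Product using (∃-syntax; proj₁; proj₂)
open import Data.Sum as Sum using (_⊎_; inj₁; inj₂)
open import Function using (_∘_)
open import Relation.Binary.PropositionalEquality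
  using (refl; sym; trans; cong; cong₂; subst; module ≡-Reasoning)

open ≡-Reasoning

ℕ-sum⇒ℤ-diff : ∀ {g c e} → g ℕ.+ c ≡ e → + g ≡ + e - + c
ℕ-sum⇒ℤ-diff {g} {c} refl = begin
  + g                 ≡⟨ r≡r+a-a (+ g) (+ c) ⟩
  + g + + c - + c     ≡⟨ cong (_- + c) (sym (pos-+ g c)) ⟩
  + (g ℕ.+ c) - + c   ∎
  where
  r≡r+a-a : ∀ r a → r ≡ r + a - a
  r≡r+a-a = solve-∀

multiple<⇒0 : ∀ {r} k m → r ℕ.< ∣ m ∣ → + r ≡ k * m → r ≡ 0
multiple<⇒0 {r} k m r<m r≡km with ∣ k ∣ | trans (cong ∣_∣ r≡km) (abs-* k m)
... | ℕ.zero  | r≡0  = r≡0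
... | ℕ.suc j | refl = ⊥-elim (ℕ.<⇒≱ r<m (ℕ.m≤m+n ∣ m ∣ (j ℕ.* ∣ m ∣)))

r+qn≡kn⇒r≡[k-q]n : ∀ r q k n → r + q * n ≡ k * n → r ≡ (k - q) * n
r+qn≡kn⇒r≡[k-q]n r q k n eq = begin
  r                     ≡⟨ r≡r+a-a r (q * n) ⟩
  r + q * n - q * n     ≡⟨ cong (_- q * n) eq ⟩
  k * n - q * n         ≡⟨ distrib k q n ⟩
  (k - q) * n           ∎
  where
  r≡r+a-a : ∀ r a → r ≡ r + a - a
  r≡r+a-a = solve-∀
  distrib : ∀ k q n → k * n - q * n ≡ (k - q) * n
  distrib = solve-∀

n∣m⇒m/n*n≡m : ∀ {m n} .{{_ : NonZero n}} → n ∣ m → m / n * n ≡ m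
n∣m⇒m/n*n≡m {m} {n} (divides k m≡kn) = sym (begin
  m                     ≡⟨ m≡r+qn ⟩
  + (m % n) + m / n * n ≡⟨ cong (λ r → + r + m / n * n) r≡0 ⟩
  + 0 + m / n * n       ≡⟨ +-identityˡ (m / n * n) ⟩
  m / n * n             ∎)
  where
  m≡r+qn = a≡a%n+[a/n]*n m n
  r≡0 : m % n ≡ 0
  r≡0 = multiple<⇒0 (k - m / n) n (n%d<d m n)
          (r+qn≡kn⇒r≡[k-q]n _ _ k n (trans (sym m≡r+qn) m≡kn))

prime∣*⇒∣⊎∣ : ∀ {p} a b → Prime p → (+ p ∣ a * b) → (+ p ∣ a) ⊎ (+ p ∣ b)
prime∣*⇒∣⊎∣ {p} a b pp p∣ab =
  Sum.map (∣ᵤ⇒∣ {+ p} {a}) (∣ᵤ⇒∣ {+ p} {b})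
    (euclidsLemma ∣ a ∣ ∣ b ∣ pp (subst (p ℕ.∣_) (abs-* a b) (∣⇒∣ᵤ p∣ab)))

prime∣²⇒∣ : ∀ {p} a → Prime p → + p ∣ a * a → + p ∣ a
prime∣²⇒∣ a pp p∣aa = Sum.reduce (prime∣*⇒∣⊎∣ a a pp p∣aa)

∣⇒²∣² : ∀ {k a} → k ∣ a → k * k ∣ a * a
∣⇒²∣² {k} {a} k∣a = ∣-trans (*-monoʳ-∣ k k∣a) (*-monoˡ-∣ a k∣a)

squareFree⇒nonZero : ∀ {m} → SquareFree m → ℕ.NonZero ∣ m ∣
squareFree⇒nonZero {+ ℕ.zero} sf with sf (+ 2) (ℕ.divides 0 refl)
... | ()
squareFree⇒nonZero {+ ℕ.suc _}  _ = _
squareFree⇒nonZero { -[1+ _ ]} _ = _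

squareFree⇒¬p²∣ : ∀ {p m} → Prime p → SquareFree m → ¬ (+ p * + p ∣ m)
squareFree⇒¬p²∣ {p} {m} pp sf p²∣m =
  ¬prime[1] (subst Prime (sf (+ p) (∣⇒∣ᵤ {+ p * + p} {m} p²∣m)) pp)

∣⇒²∣^ : ∀ {k} z {n} → 2 ℕ.≤ n → k ∣ z → k * k ∣ z ^ n
∣⇒²∣^ z {ℕ.suc (ℕ.suc m)} (ℕ.s≤s (ℕ.s≤s _)) k∣z =
  ∣-trans (∣⇒²∣² k∣z) (*-monoʳ-∣ z (∣m⇒∣m*n (z ^ m) ∣-refl))

prime∣B₀⇒∣y : ∀ {p n} C f B₀ x y z → Prime p → 2 ℕ.≤ n → SquareFree B₀ →
  x * x + f * f * B₀ * (y * y) ≡ C * z ^ n →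
  (+ p ∣ x) → (+ p ∣ z) → (+ p ∣ B₀) → ¬ (+ p ∣ f) → + p ∣ y
prime∣B₀⇒∣y {p} C f B₀ x y z pp 2≤n sf eq p∣x p∣z (divides b B₀≡bp) p∤f =
  Sum.[ ⊥-elim ∘ ¬p∣f²b , prime∣²⇒∣ y pp ]′ (prime∣*⇒∣⊎∣ (f * f * b) (y * y) pp p∣f²by²)
  where
  instance _ = prime⇒nonZero pp
  p²∣f²B₀y² : + p * + p ∣ f * f * B₀ * (y * y)
  p²∣f²B₀y² = ∣m+n∣m⇒∣n (subst (λ t → + p * + p ∣ t) (sym eq) (∣n⇒∣m*n C (∣⇒²∣^ z 2≤n p∣z)))
                         (∣⇒²∣² p∣x)
  factor-p : ∀ f y b p → f * f * (b * p) * (y * y) ≡ p * (f * f * b * (y * y))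
  factor-p = solve-∀
  p∣f²by² : + p ∣ f * f * b * (y * y)
  p∣f²by² = *-cancelˡ-∣ (+ p) (subst (λ t → + p * + p ∣ t)
    (trans (cong (λ B → f * f * B * (y * y)) B₀≡bp) (factor-p f y b (+ p))) p²∣f²B₀y²)
  ¬p∣b : ¬ (+ p ∣ b)
  ¬p∣b p∣b =
    squareFree⇒¬p²∣ pp sf (subst (λ t → + p * + p ∣ t) (sym B₀≡bp) (*-monoˡ-∣ (+ p) p∣b))
  ¬p∣f²b : ¬ (+ p ∣ f * f * b)
  ¬p∣f²b p∣f²b = Sum.[ p∤f ∘ prime∣²⇒∣ f pp , ¬p∣b ]′ (prime∣*⇒∣⊎∣ (f * f) b pp p∣f²b)

scale : ℤ → 𝒪 → 𝒪
scale k (a , b) = (k * a , k * b)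

mul-ι : ∀ d k r → mul d (ι k) r ≡ scale k r
mul-ι d k (a , b) = cong₂ _,_ (re k a b (ωc d)) (im k a b (ωt d))
  where
  re : ∀ k a b c → k * a + + 0 * b * c ≡ k * a
  re = solve-∀
  im : ∀ k a b t → k * b + a * + 0 + + 0 * b * t ≡ k * b
  im = solve-∀

scale-ι : ∀ k a → scale k (ι a) ≡ ι (k * a)
scale-ι k a = cong (k * a ,_) (*-zeroʳ k)

ι-mul : ∀ d a b → mul d (ι a) (ι b) ≡ ι (a * b)
ι-mul d a b = trans (mul-ι d a (ι b)) (scale-ι a b)

ι-pow : ∀ d a n → pow d (ι a) n ≡ ι (a ^ n)
ι-pow d a ℕ.zero    = refl
ι-pow d a (ℕ.suc n) = trans (cong (mul d (ι a)) (ι-pow d a n)) (ι-mul d a (a ^ n))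

neg≡mul-ι-1 : ∀ d r → neg r ≡ mul d (ι -1ℤ) r
neg≡mul-ι-1 d r@(a , b) = sym (trans (mul-ι d -1ℤ r) (cong₂ _,_ (-1*i≡-i a) (-1*i≡-i b)))

mul-scale-scale : ∀ d k r → mul d (scale k r) (scale k r) ≡ scale (k * k) (mul d r r)
mul-scale-scale d k (a , b) = cong₂ _,_ (re k a b (ωc d)) (im k a b (ωt d))
  where
  re : ∀ k a b c → k * a * (k * a) + k * b * (k * b) * c ≡ k * k * (a * a + b * b * c)
  re = solve-∀
  im : ∀ k a b t →
    k * a * (k * b) + k * a * (k * b) + k * b * (k * b) * t ≡ k * k * (a * b + a * b + b * b * t)
  im = solve-∀

sqrtd² : ∀ d → mul d (sqrtd d) (sqrtd d) ≡ ι d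
sqrtd² d with d≡1mod4 d in d≡1[4]
... | false = cong (_, + 0) (0²+1²d≡d d)
  where
  0²+1²d≡d : ∀ d → + 0 * + 0 + + 1 * + 1 * d ≡ d
  0²+1²d≡d = solve-∀
... | true  = cong (_, + 0) (begin
  - + 1 * - + 1 + + 2 * + 2 * ((d - + 1) / + 4) ≡⟨ reorder ((d - + 1) / + 4) ⟩
  + 1 + (d - + 1) / + 4 * + 4                 ≡⟨ cong (_+_ (+ 1)) (n∣m⇒m/n*n≡m 4∣d-1) ⟩
  + 1 + (d - + 1)                             ≡⟨ 1+[d-1]≡d d ⟩
  d                                           ∎)
  where
  reorder : ∀ q → - + 1 * - + 1 + + 2 * + 2 * q ≡ + 1 + q * + 4
  reorder = solve-∀
  1+[d-1]≡d : ∀ d → + 1 + (d - + 1) ≡ d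
  1+[d-1]≡d = solve-∀
  1+a-1≡a : ∀ a → + 1 + a - + 1 ≡ a
  1+a-1≡a = solve-∀
  d%4≡1 : d % + 4 ≡ 1
  d%4≡1 = ℕ.≡ᵇ⇒≡ (d % + 4) 1 (subst T (sym d≡1[4]) _)
  d≡1+[d/4]*4 : d ≡ + 1 + d / + 4 * + 4
  d≡1+[d/4]*4 = subst (λ r → d ≡ + r + d / + 4 * + 4) d%4≡1 (a≡a%n+[a/n]*n d (+ 4))
  4∣d-1 : + 4 ∣ d - + 1
  4∣d-1 = divides (d / + 4) (begin
    d - + 1                   ≡⟨ cong (_- + 1) d≡1+[d/4]*4 ⟩
    + 1 + d / + 4 * + 4 - + 1 ≡⟨ 1+a-1≡a (d / + 4 * + 4) ⟩
    d / + 4 * + 4             ∎)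

ι-conj-mul : ∀ d x s → mul d (add (ι x) s) (add (ι x) (neg s)) ≡ add (ι (x * x)) (neg (mul d s s))
ι-conj-mul d x (a , b) = cong₂ _,_ (re x a b (ωc d)) (im x a b (ωt d))
  where
  re : ∀ x a b c →
    (x + a) * (x + - a) + (+ 0 + b) * (+ 0 + - b) * c ≡ x * x + - (a * a + b * b * c)
  re = solve-∀
  im : ∀ x a b t →
    (x + a) * (+ 0 + - b) + (x + - a) * (+ 0 + b) + (+ 0 + b) * (+ 0 + - b) * t
      ≡ + 0 + - (a * b + a * b + b * b * t)
  im = solve-∀

ι-conj-add : ∀ x s → add (add (ι x) s) (add (ι x) (neg s)) ≡ ι (+ 2 * x)
ι-conj-add x (a , b) = cong₂ _,_ (re x a) (im b)
  where
  re : ∀ x a → x + a + (x + - a) ≡ + 2 * x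
  re = solve-∀
  im : ∀ b → + 0 + b + (+ 0 + - b) ≡ + 0
  im = solve-∀

ι-conj-sub : ∀ x s → add (add (ι x) s) (neg (add (ι x) (neg s))) ≡ scale (+ 2) s
ι-conj-sub x (a , b) = cong₂ _,_ (re x a) (im b)
  where
  re : ∀ x a → x + a + - (x + - a) ≡ + 2 * a
  re = solve-∀
  im : ∀ b → + 0 + b + - (+ 0 + - b) ≡ + 2 * b
  im = solve-∀

scaled-sqrtd² : ∀ d m → let s = mul d (ι m) (sqrtd d) in mul d s s ≡ ι (m * m * d)
scaled-sqrtd² d m = begin
  mul d (mul d (ι m) (sqrtd d)) (mul d (ι m) (sqrtd d))
    ≡⟨ cong (λ s → mul d s s) (mul-ι d m (sqrtd d)) ⟩
  mul d (scale m (sqrtd d)) (scale m (sqrtd d))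
    ≡⟨ mul-scale-scale d m (sqrtd d) ⟩
  scale (m * m) (mul d (sqrtd d) (sqrtd d))
    ≡⟨ cong (scale (m * m)) (sqrtd² d) ⟩
  scale (m * m) (ι d)
    ≡⟨ scale-ι (m * m) d ⟩
  ι (m * m * d)
    ∎

record IsPrimeIdealℤ (I : ℤ → Set) : Set where
  field
    +-closed : ∀ {a b} → I a → I b → I (a + b)
    *-closed : ∀ k {a} → I a → I (k * a)
    proper   : ¬ I 1ℤ
    prime    : ∀ a b → I (a * b) → I a ⊎ I b

  ∣-closed : ∀ {k a} → k ∣ a → I k → I a
  ∣-closed (divides q a≡qk) Ik = subst I (sym a≡qk) (*-closed q Ik)

  -‿closed : ∀ {a} → I a → I (- a)
  -‿closed {a} = ∣-closed (divides -1ℤ (sym (-1*i≡-i a)))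

  ∣∣-closed : ∀ {a} → I a → I (+ ∣ a ∣)
  ∣∣-closed = ∣-closed m∣∣m∣

  bézout-closed : ∀ {g m n} → Bézout.Identity g m n → I (+ m) → I (+ n) → I (+ g)
  bézout-closed {g} {m} {n} (Bézout.+- x y g+yn≡xm) Im In =
    subst I (sym g≡xm-yn) (+-closed (*-closed (+ x) Im) (-‿closed (*-closed (+ y) In)))
    where
    g≡xm-yn : + g ≡ + x * + m - + y * + n
    g≡xm-yn = trans (ℕ-sum⇒ℤ-diff g+yn≡xm) (cong₂ _-_ (pos-* x m) (pos-* y n))
  bézout-closed (Bézout.-+ x y eq) Im In = bézout-closed (Bézout.+- y x eq) In Im

  gcd-closed : ∀ {a b} → I a → I b → I (gcd a b)
  gcd-closed {a} {b} Ia Ib =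
    bézout-closed (Bézout.identity (ℕ.gcd-GCD ∣ a ∣ ∣ b ∣)) (∣∣-closed Ia) (∣∣-closed Ib)

  prime-factor-closed : ∀ {ps} → All Prime ps → I (+ product ps) → ∃[ p ] Prime p × I (+ p)
  prime-factor-closed []                  I1   = ⊥-elim (proper I1)
  prime-factor-closed {p ∷ ps} (pp ∷ pps) Ip*ps
    with prime (+ p) (+ product ps) (subst I (pos-* p (product ps)) Ip*ps)
  ... | inj₁ Ip  = p , pp , Ip
  ... | inj₂ Ips = prime-factor-closed pps Ips

  prime-closed : ∀ {n} .{{_ : ℕ.NonZero n}} → I (+ n) → ∃[ p ] Prime p × I (+ p)
  prime-closed {n} In = prime-factor-closed factorsPrime (subst (I ∘ +_) isFactorisation In)
    where open PrimeFactorisation (factorise n)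

  prime-closed⇒∣ : ∀ {p a} → Prime p → I (+ p) → I a → + p ∣ a
  prime-closed⇒∣ {p} {a} pp Ip Ia with prime⇒irreducible pp (ℕ.gcd[m,n]∣m p ∣ a ∣)
  ... | inj₁ gcd≡1 = ⊥-elim (proper (subst (I ∘ +_) gcd≡1 (gcd-closed Ip Ia)))
  ... | inj₂ gcd≡p = ∣ᵤ⇒∣ (subst (ℕ._∣ ∣ a ∣) gcd≡p (ℕ.gcd[m,n]∣n p ∣ a ∣))

module _ {I : ℤ → Set} (𝔮 : IsPrimeIdealℤ I) where
  open IsPrimeIdealℤ 𝔮

  ramified-closed : ∀ {n} → 2 ℕ.≤ n → ∀ C f B₀ x y z → SquareFree B₀ →
    x * x + f * f * B₀ * (y * y) ≡ C * z ^ n → I B₀ → I x → I z → ¬ I f → I y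
  ramified-closed 2≤n C f B₀ x y z sf eq B₀∈ x∈ z∈ f∉ =
    let instance _ = squareFree⇒nonZero {B₀} sf
        p , pp , p∈ = prime-closed (∣∣-closed B₀∈)
        p∣ : ∀ {a} → I a → + p ∣ a
        p∣ = prime-closed⇒∣ pp p∈
    in ∣-closed (prime∣B₀⇒∣y C f B₀ x y z pp 2≤n sf eq (p∣ x∈) (p∣ z∈) (p∣ B₀∈)
                   (λ p∣f → f∉ (∣-closed p∣f p∈))) p∈

contraction : ∀ {d P} → IsPrimeIdeal d P → IsPrimeIdealℤ (P ∘ ι)
contraction {d} {P} 𝔭 = record
  { +-closed = λ {a} {b} → +-closed (ι a) (ι b)
  ; *-closed = λ k {a} a∈ → subst P (ι-mul d k a) (*-closed (ι k) (ι a) a∈)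
  ; proper   = proper
  ; prime    = λ a b ab∈ → prime (ι a) (ι b) (subst P (sym (ι-mul d a b)) ab∈)
  }
  where open IsPrimeIdeal 𝔭

conj-closed : ∀ {d P} → IsPrimeIdeal d P → ¬ P (ι (+ 2)) → ∀ x s →
  P (add (ι x) s) → P (add (ι x) (neg s)) → P (ι x) × P s
conj-closed {d} {P} 𝔭 2∉ x s u∈ v∈ =
  Sum.fromInj₂ (⊥-elim ∘ 2∉) (prime (ι (+ 2)) (ι x) 2x∈) ,
  Sum.fromInj₂ (⊥-elim ∘ 2∉) (prime (ι (+ 2)) s 2s∈)
  where
  open IsPrimeIdeal 𝔭
  2x∈ : P (mul d (ι (+ 2)) (ι x))
  2x∈ = subst P (trans (ι-conj-add x s) (sym (ι-mul d (+ 2) x))) (+-closed _ _ u∈ v∈)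
  -v∈ : P (neg (add (ι x) (neg s)))
  -v∈ = subst P (sym (neg≡mul-ι-1 d _)) (*-closed (ι -1ℤ) _ v∈)
  2s∈ : P (mul d (ι (+ 2)) s)
  2s∈ = subst P (trans (ι-conj-sub x s) (sym (mul-ι d (+ 2) s))) (+-closed _ _ u∈ -v∈)

lemma4p1 : (n : ℕ) → n ≥ 3 → n ℕ.% 2 ≡ 1 →
    (C f B₀ B : ℤ) → ¬ C ≡ + 0 → ¬ f ≡ + 0 → SquareFree B₀ → ¬ B₀ ≡ - + 1 →
    B ≡ f * f * B₀ →
    (x y z : ℤ) → gcd (gcd x y) z ≡ + 1 → x * x + B * (y * y) ≡ C * z ^ n →
    let d = - B₀
        s = mul d (ι (y * f)) (sqrtd d)
        u = add (ι x) s
        v = add (ι x) (neg s)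
        w = ι z
    in (mul d u v ≡ mul d (ι C) (pow d w n))
       × ((P : 𝒪 → Set) → IsPrimeIdeal d P → ¬ P (ι (+ 2 * f)) → MinVal0 P u v w)
lemma4p1 n n≥3 _ C f B₀ _ _ _ sf _ refl x y z gcd≡1 eq = uv≡Cwⁿ , minVal0
  where
  d = - B₀
  s = mul d (ι (y * f)) (sqrtd d)
  x²-[yf]²d≡x²+f²B₀y² : ∀ x y f B₀ →
    x * x - y * f * (y * f) * - B₀ ≡ x * x + f * f * B₀ * (y * y)
  x²-[yf]²d≡x²+f²B₀y² = solve-∀

  uv≡Cwⁿ : mul d (add (ι x) s) (add (ι x) (neg s)) ≡ mul d (ι C) (pow d (ι z) n)
  uv≡Cwⁿ = begin
    mul d (add (ι x) s) (add (ι x) (neg s))  ≡⟨ ι-conj-mul d x s ⟩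
    add (ι (x * x)) (neg (mul d s s))
      ≡⟨ cong (add (ι (x * x)) ∘ neg) (scaled-sqrtd² d (y * f)) ⟩
    ι (x * x - y * f * (y * f) * d)          ≡⟨ cong ι (trans (x²-[yf]²d≡x²+f²B₀y² x y f B₀) eq) ⟩
    ι (C * z ^ n)                            ≡⟨ sym (ι-mul d C (z ^ n)) ⟩
    mul d (ι C) (ι (z ^ n))                  ≡⟨ cong (mul d (ι C)) (ι-pow d z n) ⟨
    mul d (ι C) (pow d (ι z) n)              ∎

  minVal0 : (P : 𝒪 → Set) → IsPrimeIdeal d P → ¬ P (ι (+ 2 * f)) →
            MinVal0 P (add (ι x) s) (add (ι x) (neg s)) (ι z)
  minVal0 P 𝔭 2f∉ (u∈ , v∈ , z∈) =
    𝔮.proper (subst (P ∘ ι) gcd≡1 (𝔮.gcd-closed (𝔮.gcd-closed x∈ y∈) z∈))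
    where
    module 𝔭 = IsPrimeIdeal 𝔭
    𝔮 = contraction 𝔭
    module 𝔮 = IsPrimeIdealℤ 𝔮
    f∉ : ¬ P (ι f)
    f∉ f∈ = 2f∉ (𝔮.∣-closed (∣n⇒∣m*n (+ 2) ∣-refl) f∈)
    2∉ : ¬ P (ι (+ 2))
    2∉ 2∈ = 2f∉ (𝔮.∣-closed (∣m⇒∣m*n f ∣-refl) 2∈)
    x∈ : P (ι x)
    x∈ = proj₁ (conj-closed 𝔭 2∉ x s u∈ v∈)
    y∈ : P (ι y)
    y∈ = Sum.[ Sum.fromInj₁ (⊥-elim ∘ f∉) ∘ 𝔮.prime y f , ramified ]′
           (𝔭.prime (ι (y * f)) (sqrtd d) (proj₂ (conj-closed 𝔭 2∉ x s u∈ v∈)))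
      where
      ramified : P (sqrtd d) → P (ι y)
      ramified √d∈ = ramified-closed 𝔮 (ℕ.<⇒≤ n≥3) C f B₀ x y z sf eq B₀∈ x∈ z∈ f∉
        where
        B₀∈ : P (ι B₀)
        B₀∈ = subst (P ∘ ι) (neg-involutive B₀)
                (𝔮.-‿closed (subst P (sqrtd² d) (𝔭.*-closed (sqrtd d) (sqrtd d) √d∈)))
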